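{- For any odd prime $p$ and any non-negative integer $k$, \[ C^{(-k-1)}_{p-1}\equiv 1\pmod{p}. \]
   Context: For any integer $k$, let $\mathrm{Li}_k(t)=\sum_{n\geq 1} t^n/n^k$ (for $k\le 0$ this is a rational function of $t$). The poly-Bernoulli numbers of type $C$, $C^{(k)}_n$ ($n\ge 0$), are defined by \[ \frac{\mathrm{Li}_{k}(1-e^{ -t})}{e^{t}-1}=\sum_{n=0}^{\infty}C^{(k)}_{n}\frac{t^n}{n!}. \] For negative upper index these are integers. -}

module Defs where

open import Data.Nat as ℕ using (ℕ; zero; suc; _!; _^_)
open import Data.Nat.Properties using (_!≢0)
open import Data.Integer as ℤ using (ℤ; +_)
open import Data.Rational using (ℚ; 0ℚ; 1ℚ; _+_; _*_; _-_; -_; _/_)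
open import Data.List using (List; []; _∷_; _++_; [_]; lookup; length)
open import Data.Maybe using (Maybe; just; nothing)

-- Formal power series over ℚ in one variable t, as coefficient sequences:
-- a series f stands for Σ_{n ≥ 0} f n · tⁿ.
Series : Set
Series = ℕ → ℚ

sumTo : ℕ → (ℕ → ℚ) → ℚ
sumTo zero    f = f 0
sumTo (suc n) f = sumTo n f + f (suc n)

mul : Series → Series → Series
mul f g n = sumTo n (λ i → f i * g (n ℕ.∸ i))

pow : Series → ℕ → Series
pow g zero    zero    = 1ℚ
pow g zero    (suc n) = 0ℚ
pow g (suc m)         = mul g (pow g m)

-- Composition f(g(t)) for a series g with zero constant term:
-- the coefficient of tⁿ is Σ_{m = 0}^{n} f m · [tⁿ] g(t)^m
-- (higher powers of g contribute nothing to tⁿ since g 0 = 0).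
comp : Series → Series → Series
comp f g n = sumTo n (λ m → f m * pow g m n)

invFact : ℕ → ℚ
invFact n = (+ 1 / (n !)) {{n !≢0}}

oneMinusExpNeg : Series
oneMinusExpNeg zero    = 0ℚ
oneMinusExpNeg (suc n) = ((-1ℚ) ^ℚ n) * invFact (suc n)
  where
  -1ℚ : ℚ
  -1ℚ = - 1ℚ
  _^ℚ_ : ℚ → ℕ → ℚ
  x ^ℚ zero  = 1ℚ
  x ^ℚ suc k = x * (x ^ℚ k)

LiNeg : ℕ → Series
LiNeg m zero    = 0ℚ
LiNeg m (suc n) = (+ (suc n ^ m)) / 1

-- Division of a series L with zero constant term by e^t - 1 = Σ_{j ≥ 1} t^j / j!.
-- The quotient h is the unique series with h · (e^t - 1) = L, i.e. for all n
--   L (n+1) = Σ_{i = 0}^{n} h i / (n + 1 - i)!,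
-- solved recursively: h n = L (n+1) - Σ_{i < n} h i / (n + 1 - i)!.
-- divFirst L n is the list [h 0, …, h (n-1)].
private
  nth : List ℚ → ℕ → ℚ
  nth []       _       = 0ℚ
  nth (x ∷ xs) zero    = x
  nth (x ∷ xs) (suc i) = nth xs i

  sumBelow : ℕ → (ℕ → ℚ) → ℚ
  sumBelow zero    f = 0ℚ
  sumBelow (suc n) f = sumBelow n f + f n

divFirst : Series → ℕ → List ℚ
divFirst L zero    = []
divFirst L (suc n) =
  let hs = divFirst L n in
  hs ++ [ L (suc n) - sumBelow n (λ i → nth hs i * invFact (suc n ℕ.∸ i)) ]

divExpMinusOne : Series → Series
divExpMinusOne L n = nth (divFirst L (suc n)) n

-- Poly-Bernoulli numbers of type C with non-positive upper index:
--   polyBernoulliCNeg m n = C^{(-m)}_n, where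
--   Li_{-m}(1 - e^{-t}) / (e^t - 1) = Σ_n C^{(-m)}_n tⁿ / n!.
polyBernoulliCNeg : ℕ → ℕ → ℚ
polyBernoulliCNeg m n =
  ((+ (n !)) / 1) * divExpMinusOne (comp (LiNeg m) oneMinusExpNeg) n

{-# OPTIONS --safe #-}
module Submission where

-- For x = 1 − e^{−t} one has x d/dx = (e^t − 1) d/dt, so L_K = Li_{−K}(1 − e^{−t}) satisfies
-- L_{K+1} = (e^t − 1) L_K′. Hence L_K = (e^t − 1) C_K with C_0 = 1 and C_{K+1} = ((e^t − 1) C_K)′,
-- and C_K is the exponential generating function of C^{(−K)}_n. By induction C_K = Σ_b c_b e^{bt}
-- is an integer combination of exponentials with Σ_b c_b = C_K(0) = 1, so by the freshman's dream
--   C^{(−K−1)}_{p−1} = [tᵖ/p!] (e^t − 1) C_K = Σ_b c_b ((1 + b)ᵖ − bᵖ) ≡ Σ_b c_b = 1 (mod p).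
-- Everything is computed on integer coefficient sequences multiplied by binomial convolution,
-- which A ↦ Σ A n tⁿ/n! turns into the Cauchy product of the rational series.

module FreshmansDream where

  open import Data.Nat as ℕ using (ℕ; zero; suc; z≤n; s≤s; _<_)
  import Data.Nat.Properties as ℕ
  import Data.Nat.Divisibility as ℕ
  open import Data.Nat.Combinatorics using (_C_; nCn≡1; nC1≡n; k>n⇒nCk≡0; nCk+nC[k+1]≡[n+1]C[k+1])
  open import Data.Nat.Primality using (Prime; euclidsLemma)
  open import Data.Integer using (ℤ; +_; _+_; _*_; _-_; 0ℤ; 1ℤ; _^_)
  open import Data.Integer.Properties
  open import Data.Integer.Divisibility.Signed using (_∣_; divides; ∣ᵤ⇒∣; ∣m∣n⇒∣m+n; ∣m⇒∣m*n)
  open import Data.Integer.Tactic.RingSolver using (solve-∀)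
  open import Data.Fin using (Fin; zero; suc; toℕ; inject₁; fromℕ)
  open import Data.Fin.Properties using (toℕ-inject₁; toℕ-fromℕ; toℕ<n)
  open import Data.Sum using (inj₁; inj₂)
  open import Relation.Nullary using (contradiction)
  open import Relation.Binary.PropositionalEquality
    using (_≡_; refl; sym; trans; cong; cong₂; subst; module ≡-Reasoning)
  open import Algebra.Properties.CommutativeSemiring.Binomial +-*-commutativeSemiring as Binomial
    using (binomial; binomialTerm)
  open import Algebra.Properties.Semiring.Sum +-*-semiring using (sum; sum-init-last)
  import Algebra.Properties.Semiring.Exp +-*-semiring as Exp
  import Algebra.Properties.Semiring.Mult +-*-semiring as Mult
  open ≡-Reasoning

  [k+1]*[n+1]C[k+1]≡[n+1]*nCk : ∀ n k → suc k ℕ.* (suc n C suc k) ≡ suc n ℕ.* (n C k)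
  [k+1]*[n+1]C[k+1]≡[n+1]*nCk zero zero = refl
  [k+1]*[n+1]C[k+1]≡[n+1]*nCk zero (suc k) = begin
    suc (suc k) ℕ.* (1 C suc (suc k))
      ≡⟨ cong (suc (suc k) ℕ.*_) (k>n⇒nCk≡0 {1} {suc (suc k)} (s≤s (s≤s z≤n))) ⟩
    suc (suc k) ℕ.* 0
      ≡⟨ ℕ.*-zeroʳ (suc (suc k)) ⟩
    0
      ≡⟨ cong (1 ℕ.*_) (k>n⇒nCk≡0 {0} {suc k} (s≤s z≤n)) ⟨
    1 ℕ.* (0 C suc k) ∎
  [k+1]*[n+1]C[k+1]≡[n+1]*nCk (suc n) zero = begin
    1 ℕ.* (suc (suc n) C 1) ≡⟨ ℕ.*-identityˡ (suc (suc n) C 1) ⟩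
    suc (suc n) C 1         ≡⟨ nC1≡n (suc (suc n)) ⟩
    suc (suc n)             ≡⟨ ℕ.*-identityʳ (suc (suc n)) ⟨
    suc (suc n) ℕ.* 1       ∎
  [k+1]*[n+1]C[k+1]≡[n+1]*nCk (suc n) (suc k) = begin
    suc (suc k) ℕ.* (suc (suc n) C suc (suc k))
      ≡⟨ cong (suc (suc k) ℕ.*_) (nCk+nC[k+1]≡[n+1]C[k+1] (suc n) (suc k)) ⟨
    suc (suc k) ℕ.* (a ℕ.+ b)
      ≡⟨ ℕ.*-distribˡ-+ (suc (suc k)) a b ⟩
    a ℕ.+ suc k ℕ.* a ℕ.+ suc (suc k) ℕ.* b
      ≡⟨ cong₂ (λ u v → a ℕ.+ u ℕ.+ v) ([k+1]*[n+1]C[k+1]≡[n+1]*nCk n k)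
                                       ([k+1]*[n+1]C[k+1]≡[n+1]*nCk n (suc k)) ⟩
    a ℕ.+ suc n ℕ.* (n C k) ℕ.+ suc n ℕ.* (n C suc k)
      ≡⟨ ℕ.+-assoc a (suc n ℕ.* (n C k)) (suc n ℕ.* (n C suc k)) ⟩
    a ℕ.+ (suc n ℕ.* (n C k) ℕ.+ suc n ℕ.* (n C suc k))
      ≡⟨ cong (a ℕ.+_) (ℕ.*-distribˡ-+ (suc n) (n C k) (n C suc k)) ⟨
    a ℕ.+ suc n ℕ.* (n C k ℕ.+ n C suc k)
      ≡⟨ cong (λ c → a ℕ.+ suc n ℕ.* c) (nCk+nC[k+1]≡[n+1]C[k+1] n k) ⟩
    suc (suc n) ℕ.* a ∎
    where
    a = suc n C suc k
    b = suc n C suc (suc k)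

  p∣pCk : ∀ {p k} → Prime p → 0 < k → k < p → p ℕ.∣ p C k
  p∣pCk {suc n} {suc j} p-prime _ k<p
    with euclidsLemma (suc j) (suc n C suc j) p-prime
           (ℕ.divides (n C j) (trans ([k+1]*[n+1]C[k+1]≡[n+1]*nCk n j) (ℕ.*-comm (suc n) (n C j))))
  ... | inj₁ p∣k   = contradiction (ℕ.∣⇒≤ p∣k) (ℕ.<⇒≱ k<p)
  ... | inj₂ p∣pCk = p∣pCk

  ∣-sum : ∀ {d n} (f : Fin n → ℤ) → (∀ i → d ∣ f i) → d ∣ sum f
  ∣-sum {n = zero}  f d∣f = divides 0ℤ refl
  ∣-sum {n = suc n} f d∣f = ∣m∣n⇒∣m+n (d∣f zero) (∣-sum (λ i → f (suc i)) (λ i → d∣f (suc i)))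

  ×≡* : ∀ m x → m Mult.× x ≡ + m * x
  ×≡* zero    x = refl
  ×≡* (suc m) x = trans (cong (_+_ x) (×≡* m x)) (sym (suc-* (+ m) x))

  Exp^≡^ : ∀ x n → x Exp.^ n ≡ x ^ n
  Exp^≡^ x zero    = refl
  Exp^≡^ x (suc n) = cong (x *_) (Exp^≡^ x n)

  freshman : ∀ {p} → Prime p → ∀ a b → + p ∣ (a + b) ^ p - (a ^ p + b ^ p)
  freshman {suc n} p-prime a b = subst (+ suc n ∣_) (sym expansion) (∣-sum middle p∣middle)
    where
    T = binomialTerm a b (suc n)
    middle : Fin n → ℤ
    middle i = T (suc (inject₁ i))
    p∣middle : ∀ i → + suc n ∣ middle i
    p∣middle i = subst (+ suc n ∣_) (sym (×≡* c _))
      (∣m⇒∣m*n (binomial a b (suc n) (suc (inject₁ i))) (∣ᵤ⇒∣ {i = + c} p∣c))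
      where
      c = suc n C suc (toℕ (inject₁ i))
      p∣c = p∣pCk p-prime (s≤s z≤n) (s≤s (subst (_< n) (sym (toℕ-inject₁ i)) (toℕ<n i)))
    first : T zero ≡ b ^ suc n
    first = begin
      1ℤ * b Exp.^ suc n + 0ℤ ≡⟨ +-identityʳ (1ℤ * b Exp.^ suc n) ⟩
      1ℤ * b Exp.^ suc n      ≡⟨ *-identityˡ (b Exp.^ suc n) ⟩
      b Exp.^ suc n           ≡⟨ Exp^≡^ b (suc n) ⟩
      b ^ suc n               ∎
    last : T (suc (fromℕ n)) ≡ a ^ suc n
    last rewrite toℕ-fromℕ n | nCn≡1 (suc n) | ℕ.n∸n≡0 n = begin
      a Exp.^ suc n * 1ℤ + 0ℤ ≡⟨ +-identityʳ (a Exp.^ suc n * 1ℤ) ⟩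
      a Exp.^ suc n * 1ℤ      ≡⟨ *-identityʳ (a Exp.^ suc n) ⟩
      a Exp.^ suc n           ≡⟨ Exp^≡^ a (suc n) ⟩
      a ^ suc n               ∎
    cancel : ∀ y m x → y + (m + x) - (x + y) ≡ m
    cancel = solve-∀
    expansion : (a + b) ^ suc n - (a ^ suc n + b ^ suc n) ≡ sum middle
    expansion = begin
      (a + b) ^ suc n - (a ^ suc n + b ^ suc n)
        ≡⟨ cong (_- (a ^ suc n + b ^ suc n))
                (trans (sym (Exp^≡^ (a + b) (suc n))) (Binomial.theorem (suc n) a b)) ⟩
      T zero + sum (λ i → T (suc i)) - (a ^ suc n + b ^ suc n)
        ≡⟨ cong (λ s → T zero + s - (a ^ suc n + b ^ suc n)) (sum-init-last (λ i → T (suc i))) ⟩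
      T zero + (sum middle + T (suc (fromℕ n))) - (a ^ suc n + b ^ suc n)
        ≡⟨ cong₂ (λ u v → u + (sum middle + v) - (a ^ suc n + b ^ suc n)) first last ⟩
      b ^ suc n + (sum middle + a ^ suc n) - (a ^ suc n + b ^ suc n)
        ≡⟨ cancel (b ^ suc n) (sum middle) (a ^ suc n) ⟩
      sum middle ∎

-- A : Seq stands for the exponential generating function Σ A n tⁿ/n!, so shift is d/dt and
-- _⋆_ is the product, defined through the Leibniz rule (A B)′ = A′ B + A B′; unfolded,
-- (A ⋆ B) n = Σᵢ (n choose i) A i B (n − i).
module BinomialConvolution where

  open import Data.Nat as ℕ using (ℕ; zero; suc; z≤n; s≤s; _≤_; _<_)
  import Data.Nat.Properties as ℕ
  open import Data.Integer using (ℤ; _+_; _*_; -_; _-_; 0ℤ; 1ℤ; _^_)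
  open import Data.Integer.Properties
  open import Algebra.Properties.CommutativeSemigroup +-commutativeSemigroup
    using () renaming (interchange to +-interchange)
  open import Algebra.Properties.CommutativeSemigroup *-commutativeSemigroup using (x∙yz≈y∙xz)
  open import Relation.Binary.PropositionalEquality
    using (_≡_; _≗_; refl; sym; trans; cong; cong₂; module ≡-Reasoning)
  open ≡-Reasoning

  Seq : Set
  Seq = ℕ → ℤ

  shift : Seq → Seq
  shift A n = A (suc n)

  infixl 6 _⊕_ _⊖_
  infixl 7 _⋆_
  infixr 8 _∙_ ⊝_

  _⊕_ _⊖_ : Seq → Seq → Seq
  (A ⊕ B) n = A n + B n
  (A ⊖ B) n = A n - B n

  ⊝_ : Seq → Seq
  (⊝ A) n = - A n

  _∙_ : ℤ → Seq → Seq
  (c ∙ A) n = c * A n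

  _⋆_ : Seq → Seq → Seq
  (A ⋆ B) zero    = A 0 * B 0
  (A ⋆ B) (suc n) = (shift A ⋆ B) n + (A ⋆ shift B) n

  δ : Seq
  δ zero    = 1ℤ
  δ (suc _) = 0ℤ

  ⋆-cong-≤ : ∀ n {A A′ B B′} → (∀ i → i ≤ n → A i ≡ A′ i) → (∀ i → i ≤ n → B i ≡ B′ i) →
             (A ⋆ B) n ≡ (A′ ⋆ B′) n
  ⋆-cong-≤ zero    A≡ B≡ = cong₂ _*_ (A≡ 0 z≤n) (B≡ 0 z≤n)
  ⋆-cong-≤ (suc n) A≡ B≡ = cong₂ _+_
    (⋆-cong-≤ n (λ i i≤n → A≡ (suc i) (s≤s i≤n)) (λ i i≤n → B≡ i (ℕ.m≤n⇒m≤1+n i≤n)))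
    (⋆-cong-≤ n (λ i i≤n → A≡ i (ℕ.m≤n⇒m≤1+n i≤n)) (λ i i≤n → B≡ (suc i) (s≤s i≤n)))

  ⋆-cong : ∀ {A A′ B B′} → A ≗ A′ → B ≗ B′ → A ⋆ B ≗ A′ ⋆ B′
  ⋆-cong A≗ B≗ n = ⋆-cong-≤ n (λ i _ → A≗ i) (λ i _ → B≗ i)

  ⋆-congʳ-< : ∀ n A {B B′} → A 0 ≡ 0ℤ → (∀ i → i < n → B i ≡ B′ i) → (A ⋆ B) n ≡ (A ⋆ B′) n
  ⋆-congʳ-< zero    A A₀≡0 _ rewrite A₀≡0 = refl
  ⋆-congʳ-< (suc n) A A₀≡0 B≡ = cong₂ _+_
    (⋆-cong-≤ n (λ _ _ → refl) (λ i i≤n → B≡ i (s≤s i≤n)))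
    (⋆-congʳ-< n A A₀≡0 (λ i i<n → B≡ (suc i) (s≤s i<n)))

  ⋆-comm : ∀ A B → A ⋆ B ≗ B ⋆ A
  ⋆-comm A B zero    = *-comm (A 0) (B 0)
  ⋆-comm A B (suc n) = trans (cong₂ _+_ (⋆-comm (shift A) B n) (⋆-comm A (shift B) n))
                             (+-comm ((B ⋆ shift A) n) ((shift B ⋆ A) n))

  ⋆-zeroʳ : ∀ A → A ⋆ (λ _ → 0ℤ) ≗ (λ _ → 0ℤ)
  ⋆-zeroʳ A zero    = *-zeroʳ (A 0)
  ⋆-zeroʳ A (suc n) = cong₂ _+_ (⋆-zeroʳ (shift A) n) (⋆-zeroʳ A n)

  ⋆-distribˡ-⊕ : ∀ A B C → A ⋆ (B ⊕ C) ≗ A ⋆ B ⊕ A ⋆ C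
  ⋆-distribˡ-⊕ A B C zero    = *-distribˡ-+ (A 0) (B 0) (C 0)
  ⋆-distribˡ-⊕ A B C (suc n) = trans
    (cong₂ _+_ (⋆-distribˡ-⊕ (shift A) B C n) (⋆-distribˡ-⊕ A (shift B) (shift C) n))
    (+-interchange ((shift A ⋆ B) n) ((shift A ⋆ C) n) ((A ⋆ shift B) n) ((A ⋆ shift C) n))

  ⋆-distribʳ-⊕ : ∀ A B C → (A ⊕ B) ⋆ C ≗ A ⋆ C ⊕ B ⋆ C
  ⋆-distribʳ-⊕ A B C n = begin
    ((A ⊕ B) ⋆ C) n        ≡⟨ ⋆-comm (A ⊕ B) C n ⟩
    (C ⋆ (A ⊕ B)) n        ≡⟨ ⋆-distribˡ-⊕ C A B n ⟩
    (C ⋆ A) n + (C ⋆ B) n  ≡⟨ cong₂ _+_ (⋆-comm C A n) (⋆-comm C B n) ⟩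
    (A ⋆ C) n + (B ⋆ C) n  ∎

  ⋆-∙ʳ : ∀ c A B → A ⋆ c ∙ B ≗ c ∙ (A ⋆ B)
  ⋆-∙ʳ c A B zero    = x∙yz≈y∙xz (A 0) c (B 0)
  ⋆-∙ʳ c A B (suc n) = trans (cong₂ _+_ (⋆-∙ʳ c (shift A) B n) (⋆-∙ʳ c A (shift B) n))
                             (sym (*-distribˡ-+ c ((shift A ⋆ B) n) ((A ⋆ shift B) n)))

  ⋆-∙ˡ : ∀ c A B → c ∙ A ⋆ B ≗ c ∙ (A ⋆ B)
  ⋆-∙ˡ c A B n = trans (⋆-comm (c ∙ A) B n) (trans (⋆-∙ʳ c B A n) (cong (c *_) (⋆-comm B A n)))

  ⋆-negʳ : ∀ A B → A ⋆ ⊝ B ≗ ⊝ (A ⋆ B)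
  ⋆-negʳ A B zero    = sym (neg-distribʳ-* (A 0) (B 0))
  ⋆-negʳ A B (suc n) = trans (cong₂ _+_ (⋆-negʳ (shift A) B n) (⋆-negʳ A (shift B) n))
                             (sym (neg-distrib-+ ((shift A ⋆ B) n) ((A ⋆ shift B) n)))

  ⋆-distribˡ-⊖ : ∀ A B C → A ⋆ (B ⊖ C) ≗ A ⋆ B ⊖ A ⋆ C
  ⋆-distribˡ-⊖ A B C n = trans (⋆-distribˡ-⊕ A B (⊝ C) n) (cong (_+_ ((A ⋆ B) n)) (⋆-negʳ A C n))

  ⋆-distribʳ-⊖ : ∀ A B C → (A ⊖ B) ⋆ C ≗ A ⋆ C ⊖ B ⋆ C
  ⋆-distribʳ-⊖ A B C n = begin
    ((A ⊖ B) ⋆ C) n        ≡⟨ ⋆-comm (A ⊖ B) C n ⟩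
    (C ⋆ (A ⊖ B)) n        ≡⟨ ⋆-distribˡ-⊖ C A B n ⟩
    (C ⋆ A) n - (C ⋆ B) n  ≡⟨ cong₂ _-_ (⋆-comm C A n) (⋆-comm C B n) ⟩
    (A ⋆ C) n - (B ⋆ C) n  ∎

  ⋆-assoc : ∀ A B C → (A ⋆ B) ⋆ C ≗ A ⋆ (B ⋆ C)
  ⋆-assoc A B C zero    = *-assoc (A 0) (B 0) (C 0)
  ⋆-assoc A B C (suc n) = begin
    ((shift A ⋆ B ⊕ A ⋆ shift B) ⋆ C) n + ((A ⋆ B) ⋆ shift C) n
      ≡⟨ cong (_+ ((A ⋆ B) ⋆ shift C) n) (⋆-distribʳ-⊕ (shift A ⋆ B) (A ⋆ shift B) C n) ⟩
    ((shift A ⋆ B) ⋆ C) n + ((A ⋆ shift B) ⋆ C) n + ((A ⋆ B) ⋆ shift C) n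
      ≡⟨ cong₂ _+_ (cong₂ _+_ (⋆-assoc (shift A) B C n) (⋆-assoc A (shift B) C n))
                   (⋆-assoc A B (shift C) n) ⟩
    (shift A ⋆ (B ⋆ C)) n + (A ⋆ (shift B ⋆ C)) n + (A ⋆ (B ⋆ shift C)) n
      ≡⟨ +-assoc ((shift A ⋆ (B ⋆ C)) n) ((A ⋆ (shift B ⋆ C)) n) ((A ⋆ (B ⋆ shift C)) n) ⟩
    (shift A ⋆ (B ⋆ C)) n + ((A ⋆ (shift B ⋆ C)) n + (A ⋆ (B ⋆ shift C)) n)
      ≡⟨ cong (_+_ ((shift A ⋆ (B ⋆ C)) n)) (⋆-distribˡ-⊕ A (shift B ⋆ C) (B ⋆ shift C) n) ⟨
    (shift A ⋆ (B ⋆ C)) n + (A ⋆ (shift B ⋆ C ⊕ B ⋆ shift C)) n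
      ∎

  ⋆-identityˡ : ∀ B → δ ⋆ B ≗ B
  ⋆-identityˡ B zero    = *-identityˡ (B 0)
  ⋆-identityˡ B (suc n) =
    trans (cong₂ _+_ (trans (⋆-comm _ B n) (⋆-zeroʳ B n)) (⋆-identityˡ (shift B) n)) (+-identityˡ (B (suc n)))

  ⋆-identityʳ : ∀ A → A ⋆ δ ≗ A
  ⋆-identityʳ A n = trans (⋆-comm A δ n) (⋆-identityˡ A n)

  ⋆-vanishing : ∀ {A B N} → A 0 ≡ 0ℤ → (∀ i → i < N → B i ≡ 0ℤ) → ∀ n → n ≤ N → (A ⋆ B) n ≡ 0ℤ
  ⋆-vanishing {A} A₀≡0 B<N≡0 n n≤N =
    trans (⋆-congʳ-< n A A₀≡0 (λ i i<n → B<N≡0 i (ℕ.<-≤-trans i<n n≤N))) (⋆-zeroʳ A n)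

  exp : ℤ → Seq
  exp b n = b ^ n

  δ≗exp0 : δ ≗ exp 0ℤ
  δ≗exp0 zero    = refl
  δ≗exp0 (suc n) = refl

  exp-⋆ : ∀ a b → exp a ⋆ exp b ≗ exp (a + b)
  exp-⋆ a b zero    = refl
  exp-⋆ a b (suc n) = begin
    (a ∙ exp a ⋆ exp b) n + (exp a ⋆ b ∙ exp b) n
      ≡⟨ cong₂ _+_ (⋆-∙ˡ a (exp a) (exp b) n) (⋆-∙ʳ b (exp a) (exp b) n) ⟩
    a * (exp a ⋆ exp b) n + b * (exp a ⋆ exp b) n
      ≡⟨ *-distribʳ-+ ((exp a ⋆ exp b) n) a b ⟨
    (a + b) * (exp a ⋆ exp b) n
      ≡⟨ cong ((a + b) *_) (exp-⋆ a b n) ⟩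
    (a + b) * (a + b) ^ n ∎

  expm1 : Seq
  expm1 zero    = 0ℤ
  expm1 (suc _) = 1ℤ

  expm1≗exp1⊖δ : expm1 ≗ exp 1ℤ ⊖ δ
  expm1≗exp1⊖δ zero    = refl
  expm1≗exp1⊖δ (suc n) = sym (begin
    1ℤ * 1ℤ ^ n - 0ℤ  ≡⟨ +-identityʳ (1ℤ * 1ℤ ^ n) ⟩
    1ℤ * 1ℤ ^ n       ≡⟨ *-identityˡ (1ℤ ^ n) ⟩
    1ℤ ^ n            ≡⟨ ^-zeroˡ n ⟩
    1ℤ                ∎)

  expm1-⋆-exp : ∀ b → expm1 ⋆ exp b ≗ exp (1ℤ + b) ⊖ exp b
  expm1-⋆-exp b n = begin
    (expm1 ⋆ exp b) n                   ≡⟨ ⋆-cong expm1≗exp1⊖δ (λ _ → refl) n ⟩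
    ((exp 1ℤ ⊖ δ) ⋆ exp b) n            ≡⟨ ⋆-distribʳ-⊖ (exp 1ℤ) δ (exp b) n ⟩
    (exp 1ℤ ⋆ exp b) n - (δ ⋆ exp b) n  ≡⟨ cong₂ _-_ (exp-⋆ 1ℤ b n) (⋆-identityˡ (exp b) n) ⟩
    (1ℤ + b) ^ n - b ^ n                ∎

module ExponentialPolynomials where

  open import Data.Nat.Primality using (Prime)
  open import Data.Integer using (ℤ; +_; _+_; _*_; -_; _-_; 0ℤ; 1ℤ; _^_)
  open import Data.Integer.Properties using (*-assoc; ^-zeroˡ)
  open import Data.Integer.Divisibility.Signed using (_∣_; divides; ∣m∣n⇒∣m+n; ∣n⇒∣m*n)
  open import Data.Integer.Tactic.RingSolver using (solve-∀)
  open import Data.List using (List; []; _∷_)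
  open import Data.Product using (_×_; _,_)
  open import Relation.Binary.PropositionalEquality
    using (_≡_; _≗_; refl; sym; cong; cong₂; subst; module ≡-Reasoning)
  open FreshmansDream using (freshman)
  open BinomialConvolution
  open ≡-Reasoning

  -- (c , b) stands for the term c e^{bt}.
  ExpPoly : Set
  ExpPoly = List (ℤ × ℤ)

  ⟦_⟧ : ExpPoly → Seq
  ⟦ [] ⟧          n = 0ℤ
  ⟦ (c , b) ∷ f ⟧ n = c * b ^ n + ⟦ f ⟧ n

  derivative : ExpPoly → ExpPoly
  derivative []            = []
  derivative ((c , b) ∷ f) = (c * b , b) ∷ derivative f

  shift-⟦⟧ : ∀ f → shift ⟦ f ⟧ ≗ ⟦ derivative f ⟧
  shift-⟦⟧ []            n = refl
  shift-⟦⟧ ((c , b) ∷ f) n = cong₂ _+_ (sym (*-assoc c b (b ^ n))) (shift-⟦⟧ f n)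

  timesExpm1 : ExpPoly → ExpPoly
  timesExpm1 []            = []
  timesExpm1 ((c , b) ∷ f) = (c , 1ℤ + b) ∷ (- c , b) ∷ timesExpm1 f

  expm1-⋆-⟦⟧ : ∀ f → expm1 ⋆ ⟦ f ⟧ ≗ ⟦ timesExpm1 f ⟧
  expm1-⋆-⟦⟧ []            n = ⋆-zeroʳ expm1 n
  expm1-⋆-⟦⟧ ((c , b) ∷ f) n = begin
    (expm1 ⋆ (c ∙ exp b ⊕ ⟦ f ⟧)) n
      ≡⟨ ⋆-distribˡ-⊕ expm1 (c ∙ exp b) ⟦ f ⟧ n ⟩
    (expm1 ⋆ c ∙ exp b) n + (expm1 ⋆ ⟦ f ⟧) n
      ≡⟨ cong₂ _+_ (⋆-∙ʳ c expm1 (exp b) n) (expm1-⋆-⟦⟧ f n) ⟩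
    c * (expm1 ⋆ exp b) n + ⟦ timesExpm1 f ⟧ n
      ≡⟨ cong (λ z → c * z + ⟦ timesExpm1 f ⟧ n) (expm1-⋆-exp b n) ⟩
    c * ((1ℤ + b) ^ n - b ^ n) + ⟦ timesExpm1 f ⟧ n
      ≡⟨ distribute c ((1ℤ + b) ^ n) (b ^ n) (⟦ timesExpm1 f ⟧ n) ⟩
    c * (1ℤ + b) ^ n + (- c * b ^ n + ⟦ timesExpm1 f ⟧ n) ∎
    where
    distribute : ∀ c s t r → c * (s - t) + r ≡ c * s + (- c * t + r)
    distribute = solve-∀

  timesExpm1-congruence : ∀ {p} → Prime p → ∀ f → + p ∣ ⟦ timesExpm1 f ⟧ p - ⟦ f ⟧ 0
  timesExpm1-congruence p-prime []                = divides 0ℤ refl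
  timesExpm1-congruence {p} p-prime ((c , b) ∷ f) = subst (+ p ∣_) (sym regroup)
    (∣m∣n⇒∣m+n (∣n⇒∣m*n c (freshman p-prime 1ℤ b)) (timesExpm1-congruence p-prime f))
    where
    rearrange : ∀ c s t r r₀ → c * s + (- c * t + r) - (c * 1ℤ + r₀) ≡ c * (s - (1ℤ + t)) + (r - r₀)
    rearrange = solve-∀
    R = ⟦ timesExpm1 f ⟧ p - ⟦ f ⟧ 0
    regroup : ⟦ timesExpm1 ((c , b) ∷ f) ⟧ p - ⟦ (c , b) ∷ f ⟧ 0 ≡ c * ((1ℤ + b) ^ p - (1ℤ ^ p + b ^ p)) + R
    regroup = begin
      ⟦ timesExpm1 ((c , b) ∷ f) ⟧ p - ⟦ (c , b) ∷ f ⟧ 0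
        ≡⟨ rearrange c ((1ℤ + b) ^ p) (b ^ p) (⟦ timesExpm1 f ⟧ p) (⟦ f ⟧ 0) ⟩
      c * ((1ℤ + b) ^ p - (1ℤ + b ^ p)) + R
        ≡⟨ cong (λ one → c * ((1ℤ + b) ^ p - (one + b ^ p)) + R) (^-zeroˡ p) ⟨
      c * ((1ℤ + b) ^ p - (1ℤ ^ p + b ^ p)) + R ∎

module PolyBernoulliIntegral where

  open import Data.Nat as ℕ using (ℕ; zero; suc; s≤s; _≤_; _<_; _∸_)
  import Data.Nat.Properties as ℕ
  open import Data.Nat.Primality using (Prime; ¬prime[0])
  open import Data.Integer using (+_; _+_; _*_; -_; _-_; 0ℤ; 1ℤ)
  open import Data.Integer.Properties
  open import Data.Integer.Divisibility.Signed using (_∣_)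
  open import Data.Integer.Tactic.RingSolver using (solve-∀)
  open import Data.List using ([]; _∷_)
  open import Data.Product using (Σ; _,_)
  open import Relation.Nullary using (contradiction)
  open import Relation.Binary.PropositionalEquality
    using (_≡_; _≗_; refl; sym; trans; cong; cong₂; subst; module ≡-Reasoning)
  open BinomialConvolution
  open ExponentialPolynomials
  open ≡-Reasoning

  -- alt = e^{−t} and X = 1 − e^{−t}, the argument substituted into Li_{−K}.
  alt : Seq
  alt = exp (- 1ℤ)

  X : Seq
  X zero    = 0ℤ
  X (suc n) = alt n

  X≗δ⊖alt : X ≗ δ ⊖ alt
  X≗δ⊖alt zero    = refl
  X≗δ⊖alt (suc n) = sym (0-[-1*x]≡x (alt n))
    where
    0-[-1*x]≡x : ∀ x → 0ℤ - (- 1ℤ * x) ≡ x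
    0-[-1*x]≡x = solve-∀

  expm1-⋆-alt : expm1 ⋆ alt ≗ X
  expm1-⋆-alt n = begin
    (expm1 ⋆ alt) n      ≡⟨ expm1-⋆-exp (- 1ℤ) n ⟩
    exp 0ℤ n - alt n     ≡⟨ cong (_- alt n) (δ≗exp0 n) ⟨
    δ n - alt n          ≡⟨ X≗δ⊖alt n ⟨
    X n                  ∎

  expm1-⋆-X : expm1 ⋆ X ≗ expm1 ⊖ X
  expm1-⋆-X n = begin
    (expm1 ⋆ X) n                    ≡⟨ ⋆-cong (λ _ → refl) X≗δ⊖alt n ⟩
    (expm1 ⋆ (δ ⊖ alt)) n            ≡⟨ ⋆-distribˡ-⊖ expm1 δ alt n ⟩
    (expm1 ⋆ δ) n - (expm1 ⋆ alt) n  ≡⟨ cong₂ _-_ (⋆-identityʳ expm1 n) (expm1-⋆-alt n) ⟩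
    expm1 n - X n                    ∎

  X^_ : ℕ → Seq
  X^ zero  = δ
  X^ suc j = X ⋆ X^ j

  X^-vanishing : ∀ j i → i < j → (X^ j) i ≡ 0ℤ
  X^-vanishing (suc j) i (s≤s i≤j) = ⋆-vanishing refl (X^-vanishing j) i i≤j

  expm1-⋆-shift-X^ : ∀ j → expm1 ⋆ shift (X^ j) ≗ (+ j) ∙ X^ j
  expm1-⋆-shift-X^ zero    n = ⋆-zeroʳ expm1 n
  expm1-⋆-shift-X^ (suc j) n = begin
    (expm1 ⋆ (alt ⋆ X^ j ⊕ X ⋆ shift (X^ j))) n
      ≡⟨ ⋆-distribˡ-⊕ expm1 (alt ⋆ X^ j) (X ⋆ shift (X^ j)) n ⟩
    (expm1 ⋆ (alt ⋆ X^ j)) n + (expm1 ⋆ (X ⋆ shift (X^ j))) n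
      ≡⟨ cong₂ _+_ (⋆-assoc expm1 alt (X^ j) n) (⋆-assoc expm1 X (shift (X^ j)) n) ⟨
    ((expm1 ⋆ alt) ⋆ X^ j) n + ((expm1 ⋆ X) ⋆ shift (X^ j)) n
      ≡⟨ cong₂ _+_ (⋆-cong expm1-⋆-alt (λ _ → refl) n)
                   (⋆-cong (⋆-comm expm1 X) (λ _ → refl) n) ⟩
    (X ⋆ X^ j) n + ((X ⋆ expm1) ⋆ shift (X^ j)) n
      ≡⟨ cong (_+_ ((X ⋆ X^ j) n)) (⋆-assoc X expm1 (shift (X^ j)) n) ⟩
    (X ⋆ X^ j) n + (X ⋆ (expm1 ⋆ shift (X^ j))) n
      ≡⟨ cong (_+_ ((X ⋆ X^ j) n)) (⋆-cong (λ _ → refl) (expm1-⋆-shift-X^ j) n) ⟩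
    (X ⋆ X^ j) n + (X ⋆ (+ j) ∙ X^ j) n
      ≡⟨ cong (_+_ ((X ⋆ X^ j) n)) (⋆-∙ʳ (+ j) X (X^ j) n) ⟩
    (X ⋆ X^ j) n + + j * (X ⋆ X^ j) n
      ≡⟨ suc-* (+ j) ((X ⋆ X^ j) n) ⟨
    + suc j * (X ⋆ X^ j) n ∎

  -- Li K N = Σ_{m=1}^{N} m^K Xᵐ. As Xᵐ = O(tᵐ), its coefficients of index ≤ N are those
  -- of Li_{−K}(1 − e^{−t}).
  Li : ℕ → ℕ → Seq
  Li K zero    = λ _ → 0ℤ
  Li K (suc N) = Li K N ⊕ (+ (suc N ℕ.^ K)) ∙ X^ suc N

  Li-zero : ∀ N → Li 0 N ≗ expm1 ⊖ expm1 ⋆ X^ N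
  Li-zero zero    n = sym (trans (cong (_-_ (expm1 n)) (⋆-identityʳ expm1 n)) (+-inverseʳ (expm1 n)))
  Li-zero (suc N) n = begin
    Li 0 N n + 1ℤ * (X ⋆ X^ N) n
      ≡⟨ cong (_+ 1ℤ * (X ⋆ X^ N) n) (Li-zero N n) ⟩
    expm1 n - (expm1 ⋆ X^ N) n + 1ℤ * (X ⋆ X^ N) n
      ≡⟨ regroup (expm1 n) ((expm1 ⋆ X^ N) n) ((X ⋆ X^ N) n) ⟩
    expm1 n - ((expm1 ⋆ X^ N) n - (X ⋆ X^ N) n)
      ≡⟨ cong (_-_ (expm1 n)) (⋆-distribʳ-⊖ expm1 X (X^ N) n) ⟨
    expm1 n - ((expm1 ⊖ X) ⋆ X^ N) n
      ≡⟨ cong (_-_ (expm1 n)) (⋆-cong (λ i → sym (expm1-⋆-X i)) (λ _ → refl) n) ⟩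
    expm1 n - ((expm1 ⋆ X) ⋆ X^ N) n
      ≡⟨ cong (_-_ (expm1 n)) (⋆-assoc expm1 X (X^ N) n) ⟩
    expm1 n - (expm1 ⋆ (X ⋆ X^ N)) n ∎
    where
    regroup : ∀ e a x → e - a + 1ℤ * x ≡ e - (a - x)
    regroup = solve-∀

  Li-suc : ∀ K N → Li (suc K) N ≗ expm1 ⋆ shift (Li K N)
  Li-suc K zero    n = sym (⋆-zeroʳ expm1 n)
  Li-suc K (suc N) n = begin
    Li (suc K) N n + + (m ℕ.* m ℕ.^ K) * (X^ m) n
      ≡⟨ cong₂ _+_ (Li-suc K N n)
                   (trans (cong (_* (X^ m) n) (pos-* m (m ℕ.^ K))) (reassociate (+ m) c ((X^ m) n))) ⟩
    (expm1 ⋆ shift (Li K N)) n + c * (+ m * (X^ m) n)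
      ≡⟨ cong (λ z → (expm1 ⋆ shift (Li K N)) n + c * z) (expm1-⋆-shift-X^ m n) ⟨
    (expm1 ⋆ shift (Li K N)) n + c * (expm1 ⋆ shift (X^ m)) n
      ≡⟨ cong (_+_ ((expm1 ⋆ shift (Li K N)) n)) (⋆-∙ʳ c expm1 (shift (X^ m)) n) ⟨
    (expm1 ⋆ shift (Li K N)) n + (expm1 ⋆ c ∙ shift (X^ m)) n
      ≡⟨ ⋆-distribˡ-⊕ expm1 (shift (Li K N)) (c ∙ shift (X^ m)) n ⟨
    (expm1 ⋆ shift (Li K (suc N))) n ∎
    where
    m = suc N
    c = + (m ℕ.^ K)
    reassociate : ∀ m c x → m * c * x ≡ c * (m * x)
    reassociate = solve-∀

  polyC : ℕ → Seq
  polyC zero    = δ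
  polyC (suc K) = shift (expm1 ⋆ polyC K)

  Li≡expm1⋆polyC : ∀ K N n → n ≤ N → Li K N n ≡ (expm1 ⋆ polyC K) n
  Li≡expm1⋆polyC zero N n n≤N = begin
    Li 0 N n                    ≡⟨ Li-zero N n ⟩
    expm1 n - (expm1 ⋆ X^ N) n  ≡⟨ cong (_-_ (expm1 n)) (⋆-vanishing refl (X^-vanishing N) n n≤N) ⟩
    expm1 n - 0ℤ                ≡⟨ +-identityʳ (expm1 n) ⟩
    expm1 n                     ≡⟨ ⋆-identityʳ expm1 n ⟨
    (expm1 ⋆ δ) n               ∎
  Li≡expm1⋆polyC (suc K) N n n≤N = trans (Li-suc K N n)
    (⋆-congʳ-< n expm1 refl (λ i i<n → Li≡expm1⋆polyC K N (suc i) (ℕ.≤-trans i<n n≤N)))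

  polyC-0≡1 : ∀ K → polyC K 0 ≡ 1ℤ
  polyC-0≡1 zero    = refl
  polyC-0≡1 (suc K) = begin
    1ℤ * polyC K 0 + 0ℤ  ≡⟨ +-identityʳ (1ℤ * polyC K 0) ⟩
    1ℤ * polyC K 0       ≡⟨ *-identityˡ (polyC K 0) ⟩
    polyC K 0            ≡⟨ polyC-0≡1 K ⟩
    1ℤ                   ∎

  polyC-expPoly : ∀ K → Σ ExpPoly (λ f → polyC K ≗ ⟦ f ⟧)
  polyC-expPoly zero    = (1ℤ , 0ℤ) ∷ [] , λ { zero → refl ; (suc n) → refl }
  polyC-expPoly (suc K) with polyC-expPoly K
  ... | f , polyC≗f = derivative (timesExpm1 f) , λ n → begin
    (expm1 ⋆ polyC K) (suc n)         ≡⟨ ⋆-cong (λ _ → refl) polyC≗f (suc n) ⟩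
    (expm1 ⋆ ⟦ f ⟧) (suc n)           ≡⟨ expm1-⋆-⟦⟧ f (suc n) ⟩
    ⟦ timesExpm1 f ⟧ (suc n)          ≡⟨ shift-⟦⟧ (timesExpm1 f) n ⟩
    ⟦ derivative (timesExpm1 f) ⟧ n   ∎

  polyC-congruence : ∀ {p} → Prime p → ∀ K → + p ∣ polyC (suc K) (p ∸ 1) - 1ℤ
  polyC-congruence {zero}  p-prime = contradiction p-prime ¬prime[0]
  polyC-congruence {suc p} p-prime K with polyC-expPoly K
  ... | f , polyC≗f =
    subst (+ suc p ∣_) (cong₂ _-_ ⟦timesExpm1-f⟧≡ ⟦f⟧0≡1) (timesExpm1-congruence p-prime f)
    where
    ⟦timesExpm1-f⟧≡ : ⟦ timesExpm1 f ⟧ (suc p) ≡ (expm1 ⋆ polyC K) (suc p)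
    ⟦timesExpm1-f⟧≡ = sym (trans (⋆-cong (λ _ → refl) polyC≗f (suc p)) (expm1-⋆-⟦⟧ f (suc p)))
    ⟦f⟧0≡1 : ⟦ f ⟧ 0 ≡ 1ℤ
    ⟦f⟧0≡1 = trans (sym (polyC≗f 0)) (polyC-0≡1 K)

module ExponentialSeries where

  open import Defs using (Series; sumTo; mul; invFact)
  open import Data.Nat as ℕ using (ℕ; zero; suc; _≤_; z≤n; _∸_; _!)
  import Data.Nat.Properties as ℕ
  open import Data.Integer as ℤ using (ℤ; +_; 1ℤ)
  import Data.Integer.Properties as ℤ
  open import Data.Integer.Tactic.RingSolver using (solve-∀)
  open import Data.Rational using (ℚ; 0ℚ; 1ℚ; _+_; _*_; _/_; toℚᵘ)
  open import Data.Rational.Properties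
  open import Data.Rational.Unnormalised as ℚᵘ using (mkℚᵘ; *≡*)
  import Data.Rational.Unnormalised.Properties as ℚᵘ
  open import Algebra.Bundles using (CommutativeMonoid)
  open import Algebra.Properties.CommutativeSemigroup (CommutativeMonoid.commutativeSemigroup +-0-commutativeMonoid)
    using () renaming (interchange to +-interchange)
  open import Algebra.Properties.CommutativeSemigroup (CommutativeMonoid.commutativeSemigroup *-1-commutativeMonoid)
    using (x∙yz≈y∙xz)
  open import Relation.Binary.PropositionalEquality
    using (_≡_; refl; sym; trans; cong; cong₂; module ≡-Reasoning)
  open BinomialConvolution using (Seq; shift; _⋆_; _⊕_; _∙_)

  ι : ℤ → ℚ
  ι z = z / 1

  toℚᵘ-ι : ∀ z → toℚᵘ (ι z) ℚᵘ.≃ mkℚᵘ z 0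
  toℚᵘ-ι z = toℚᵘ-fromℚᵘ (mkℚᵘ z 0)

  ι-+ : ∀ a b → ι (a ℤ.+ b) ≡ ι a + ι b
  ι-+ a b = toℚᵘ-injective (begin-equality
    toℚᵘ (ι (a ℤ.+ b))           ≃⟨ toℚᵘ-ι (a ℤ.+ b) ⟩
    mkℚᵘ (a ℤ.+ b) 0             ≃⟨ *≡* (cross-multiplied a b) ⟨
    mkℚᵘ a 0 ℚᵘ.+ mkℚᵘ b 0       ≃⟨ ℚᵘ.+-cong (toℚᵘ-ι a) (toℚᵘ-ι b) ⟨
    toℚᵘ (ι a) ℚᵘ.+ toℚᵘ (ι b)   ≃⟨ toℚᵘ-homo-+ (ι a) (ι b) ⟨
    toℚᵘ (ι a + ι b)             ∎)
    where
    open ℚᵘ.≤-Reasoning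
    cross-multiplied : ∀ a b → (a ℤ.* 1ℤ ℤ.+ b ℤ.* 1ℤ) ℤ.* 1ℤ ≡ (a ℤ.+ b) ℤ.* 1ℤ
    cross-multiplied = solve-∀

  ι-* : ∀ a b → ι (a ℤ.* b) ≡ ι a * ι b
  ι-* a b = toℚᵘ-injective (begin-equality
    toℚᵘ (ι (a ℤ.* b))           ≃⟨ toℚᵘ-ι (a ℤ.* b) ⟩
    mkℚᵘ (a ℤ.* b) 0             ≃⟨ *≡* refl ⟩
    mkℚᵘ a 0 ℚᵘ.* mkℚᵘ b 0       ≃⟨ ℚᵘ.*-cong (toℚᵘ-ι a) (toℚᵘ-ι b) ⟨
    toℚᵘ (ι a) ℚᵘ.* toℚᵘ (ι b)   ≃⟨ toℚᵘ-homo-* (ι a) (ι b) ⟨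
    toℚᵘ (ι a * ι b)             ∎)
    where open ℚᵘ.≤-Reasoning

  ι-n*1/n : ∀ n .{{_ : ℕ.NonZero n}} → ι (+ n) * (+ 1 / n) ≡ 1ℚ
  ι-n*1/n (suc n) = toℚᵘ-injective (begin-equality
    toℚᵘ (ι (+ suc n) * (+ 1 / suc n))
      ≃⟨ toℚᵘ-homo-* (ι (+ suc n)) (+ 1 / suc n) ⟩
    toℚᵘ (ι (+ suc n)) ℚᵘ.* toℚᵘ (+ 1 / suc n)
      ≃⟨ ℚᵘ.*-cong (toℚᵘ-ι (+ suc n)) (toℚᵘ-fromℚᵘ (mkℚᵘ (+ 1) n)) ⟩
    mkℚᵘ (+ suc n) 0 ℚᵘ.* ℚᵘ.1/ mkℚᵘ (+ suc n) 0
      ≃⟨ ℚᵘ.*-inverseʳ (mkℚᵘ (+ suc n) 0) ⟩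
    ℚᵘ.1ℚᵘ ∎)
    where open ℚᵘ.≤-Reasoning

  open ≡-Reasoning

  ι-n!*invFact : ∀ n → ι (+ (n !)) * invFact n ≡ 1ℚ
  ι-n!*invFact n = ι-n*1/n (n !) {{n ℕ.!≢0}}

  *-cancelˡ-invertible : ∀ {a b x y} → b * a ≡ 1ℚ → a * x ≡ a * y → x ≡ y
  *-cancelˡ-invertible {a} {b} {x} {y} b*a≡1 a*x≡a*y = begin
    x            ≡⟨ *-identityˡ x ⟨
    1ℚ * x       ≡⟨ cong (_* x) b*a≡1 ⟨
    (b * a) * x  ≡⟨ *-assoc b a x ⟩
    b * (a * x)  ≡⟨ cong (b *_) a*x≡a*y ⟩
    b * (a * y)  ≡⟨ *-assoc b a y ⟨
    (b * a) * y  ≡⟨ cong (_* y) b*a≡1 ⟩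
    1ℚ * y       ≡⟨ *-identityˡ y ⟩
    y            ∎

  ι-suc*invFact : ∀ n → ι (+ suc n) * invFact (suc n) ≡ invFact n
  ι-suc*invFact n = *-cancelˡ-invertible {a = ι (+ (n !))} {b = invFact n}
    (trans (*-comm (invFact n) (ι (+ (n !)))) (ι-n!*invFact n)) (begin
      ι (+ (n !)) * (ι (+ suc n) * invFact (suc n))
        ≡⟨ *-assoc (ι (+ (n !))) (ι (+ suc n)) (invFact (suc n)) ⟨
      (ι (+ (n !)) * ι (+ suc n)) * invFact (suc n)
        ≡⟨ cong (_* invFact (suc n)) (ι-* (+ (n !)) (+ suc n)) ⟨
      ι (+ (n !) ℤ.* + suc n) * invFact (suc n)
        ≡⟨ cong (λ z → ι z * invFact (suc n)) (ℤ.pos-* (n !) (suc n)) ⟨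
      ι (+ (n ! ℕ.* suc n)) * invFact (suc n)
        ≡⟨ cong (λ z → ι (+ z) * invFact (suc n)) (ℕ.*-comm (n !) (suc n)) ⟩
      ι (+ (suc n !)) * invFact (suc n)
        ≡⟨ ι-n!*invFact (suc n) ⟩
      1ℚ
        ≡⟨ ι-n!*invFact n ⟨
      ι (+ (n !)) * invFact n ∎)

  egf : Seq → Series
  egf A n = ι (A n) * invFact n

  egf-⊕ : ∀ A B n → egf (A ⊕ B) n ≡ egf A n + egf B n
  egf-⊕ A B n = trans (cong (_* invFact n) (ι-+ (A n) (B n))) (*-distribʳ-+ (invFact n) (ι (A n)) (ι (B n)))

  egf-∙ : ∀ c A n → egf (c ∙ A) n ≡ ι c * egf A n
  egf-∙ c A n = trans (cong (_* invFact n) (ι-* c (A n))) (*-assoc (ι c) (ι (A n)) (invFact n))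

  ∂ : Series → Series
  ∂ f n = ι (+ suc n) * f (suc n)

  ∂-egf : ∀ A n → ∂ (egf A) n ≡ egf (shift A) n
  ∂-egf A n = trans (x∙yz≈y∙xz (ι (+ suc n)) (ι (A (suc n))) (invFact (suc n)))
                    (cong (ι (A (suc n)) *_) (ι-suc*invFact n))

  ∂-cancel : ∀ {f g} n → ∂ f n ≡ ∂ g n → f (suc n) ≡ g (suc n)
  ∂-cancel n = *-cancelˡ-invertible {b = ι (+ (n !)) * invFact (suc n)} (begin
    ι (+ (n !)) * invFact (suc n) * ι (+ suc n)
      ≡⟨ *-assoc (ι (+ (n !))) (invFact (suc n)) (ι (+ suc n)) ⟩
    ι (+ (n !)) * (invFact (suc n) * ι (+ suc n))
      ≡⟨ cong (ι (+ (n !)) *_) (trans (*-comm (invFact (suc n)) (ι (+ suc n))) (ι-suc*invFact n)) ⟩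
    ι (+ (n !)) * invFact n
      ≡⟨ ι-n!*invFact n ⟩
    1ℚ ∎)

  sumTo-cong : ∀ n {f g} → (∀ i → i ≤ n → f i ≡ g i) → sumTo n f ≡ sumTo n g
  sumTo-cong zero    f≡g = f≡g 0 z≤n
  sumTo-cong (suc n) f≡g =
    cong₂ _+_ (sumTo-cong n (λ i i≤n → f≡g i (ℕ.m≤n⇒m≤1+n i≤n))) (f≡g (suc n) ℕ.≤-refl)

  sumTo-+ : ∀ n f g → sumTo n (λ i → f i + g i) ≡ sumTo n f + sumTo n g
  sumTo-+ zero    f g = refl
  sumTo-+ (suc n) f g = trans (cong (_+ (f (suc n) + g (suc n))) (sumTo-+ n f g))
                              (+-interchange (sumTo n f) (sumTo n g) (f (suc n)) (g (suc n)))

  sumTo-*ˡ : ∀ n c f → sumTo n (λ i → c * f i) ≡ c * sumTo n f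
  sumTo-*ˡ zero    c f = refl
  sumTo-*ˡ (suc n) c f =
    trans (cong (_+ c * f (suc n)) (sumTo-*ˡ n c f)) (sym (*-distribˡ-+ c (sumTo n f) (f (suc n))))

  sumTo-suc : ∀ n f → sumTo (suc n) f ≡ f 0 + sumTo n (λ i → f (suc i))
  sumTo-suc zero    f = refl
  sumTo-suc (suc n) f = trans (cong (_+ f (suc (suc n))) (sumTo-suc n f))
                              (+-assoc (f 0) (sumTo n (λ i → f (suc i))) (f (suc (suc n))))

  mul-cong : ∀ {f f′ g g′} → (∀ i → f i ≡ f′ i) → (∀ i → g i ≡ g′ i) → ∀ n → mul f g n ≡ mul f′ g′ n
  mul-cong f≡ g≡ n = sumTo-cong n (λ i _ → cong₂ _*_ (f≡ i) (g≡ (n ∸ i)))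

  ∂-mul : ∀ f g n → ∂ (mul f g) n ≡ mul (∂ f) g n + mul f (∂ g) n
  ∂-mul f g n = begin
    ι (+ suc n) * mul f g (suc n)
      ≡⟨ sumTo-*ˡ (suc n) (ι (+ suc n)) (λ i → f i * g (suc n ∸ i)) ⟨
    sumTo (suc n) (λ i → ι (+ suc n) * (f i * g (suc n ∸ i)))
      ≡⟨ sumTo-cong (suc n) (λ i i≤1+n → product-rule i (suc n ∸ i) (ℕ.m+[n∸m]≡n i≤1+n)) ⟩
    sumTo (suc n) (λ i → F i + G i)
      ≡⟨ sumTo-+ (suc n) F G ⟩
    sumTo (suc n) F + sumTo (suc n) G
      ≡⟨ cong₂ _+_ F-sum G-sum ⟩
    mul (∂ f) g n + mul f (∂ g) n ∎
    where
    F G : ℕ → ℚ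
    F i = (ι (+ i) * f i) * g (suc n ∸ i)
    G i = f i * (ι (+ (suc n ∸ i)) * g (suc n ∸ i))
    product-rule : ∀ i j {m} → i ℕ.+ j ≡ m →
                   ι (+ m) * (f i * g j) ≡ (ι (+ i) * f i) * g j + f i * (ι (+ j) * g j)
    product-rule i j refl = begin
      ι (+ (i ℕ.+ j)) * (f i * g j)
        ≡⟨ cong (_* (f i * g j)) (ι-+ (+ i) (+ j)) ⟩
      (ι (+ i) + ι (+ j)) * (f i * g j)
        ≡⟨ *-distribʳ-+ (f i * g j) (ι (+ i)) (ι (+ j)) ⟩
      ι (+ i) * (f i * g j) + ι (+ j) * (f i * g j)
        ≡⟨ cong₂ _+_ (*-assoc (ι (+ i)) (f i) (g j)) (x∙yz≈y∙xz (f i) (ι (+ j)) (g j)) ⟨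
      (ι (+ i) * f i) * g j + f i * (ι (+ j) * g j) ∎
    F-sum : sumTo (suc n) F ≡ mul (∂ f) g n
    F-sum = begin
      sumTo (suc n) F                  ≡⟨ sumTo-suc n F ⟩
      (0ℚ * f 0) * g (suc n) + mul (∂ f) g n
        ≡⟨ cong (_+ mul (∂ f) g n) (trans (cong (_* g (suc n)) (*-zeroˡ (f 0))) (*-zeroˡ (g (suc n)))) ⟩
      0ℚ + mul (∂ f) g n               ≡⟨ +-identityˡ (mul (∂ f) g n) ⟩
      mul (∂ f) g n                    ∎
    G-sum : sumTo (suc n) G ≡ mul f (∂ g) n
    G-sum = begin
      sumTo n G + G (suc n)   ≡⟨ cong₂ _+_ (sumTo-cong n lower-terms) top-vanishes ⟩
      mul f (∂ g) n + 0ℚ      ≡⟨ +-identityʳ (mul f (∂ g) n) ⟩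
      mul f (∂ g) n           ∎
      where
      lower-terms : ∀ i → i ℕ.≤ n → G i ≡ f i * ∂ g (n ∸ i)
      lower-terms i i≤n = cong (λ k → f i * (ι (+ k) * g k)) (ℕ.+-∸-assoc 1 i≤n)
      top-vanishes : G (suc n) ≡ 0ℚ
      top-vanishes rewrite ℕ.n∸n≡0 n = trans (cong (f (suc n) *_) (*-zeroˡ (g 0))) (*-zeroʳ (f (suc n)))

  mul-egf : ∀ A B n → mul (egf A) (egf B) n ≡ egf (A ⋆ B) n
  mul-egf A B zero = begin
    (ι (A 0) * 1ℚ) * (ι (B 0) * 1ℚ)  ≡⟨ cong₂ _*_ (*-identityʳ (ι (A 0))) (*-identityʳ (ι (B 0))) ⟩
    ι (A 0) * ι (B 0)                ≡⟨ ι-* (A 0) (B 0) ⟨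
    ι (A 0 ℤ.* B 0)                  ≡⟨ *-identityʳ (ι (A 0 ℤ.* B 0)) ⟨
    ι (A 0 ℤ.* B 0) * 1ℚ             ∎
  mul-egf A B (suc n) = ∂-cancel {mul (egf A) (egf B)} {egf (A ⋆ B)} n (begin
    ∂ (mul (egf A) (egf B)) n
      ≡⟨ ∂-mul (egf A) (egf B) n ⟩
    mul (∂ (egf A)) (egf B) n + mul (egf A) (∂ (egf B)) n
      ≡⟨ cong₂ _+_ (mul-cong {g = egf B} (∂-egf A) (λ _ → refl) n)
                   (mul-cong {f = egf A} (λ _ → refl) (∂-egf B) n) ⟩
    mul (egf (shift A)) (egf B) n + mul (egf A) (egf (shift B)) n
      ≡⟨ cong₂ _+_ (mul-egf (shift A) B n) (mul-egf A (shift B) n) ⟩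
    egf (shift A ⋆ B) n + egf (A ⋆ shift B) n
      ≡⟨ egf-⊕ (shift A ⋆ B) (A ⋆ shift B) n ⟨
    egf (shift (A ⋆ B)) n
      ≡⟨ ∂-egf (A ⋆ B) n ⟨
    ∂ (egf (A ⋆ B)) n ∎)

module PolyBernoulliRational where

  open import Defs
  open import Data.Nat as ℕ using (ℕ; zero; suc; s≤s; _<_; _∸_; _!)
  import Data.Nat.Properties as ℕ
  open import Data.Integer as ℤ using (+_; 1ℤ)
  open import Data.Rational using (ℚ; 0ℚ; 1ℚ; _+_; _*_; _-_; -_)
  open import Data.Rational.Properties
  open import Algebra.Bundles using (CommutativeMonoid)
  open import Algebra.Properties.CommutativeSemigroup (CommutativeMonoid.commutativeSemigroup *-1-commutativeMonoid)
    using (x∙yz≈y∙xz)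
  open import Algebra.Properties.AbelianGroup +-0-abelianGroup using (xyx⁻¹≈y)
  open import Data.List using (List; []; _∷_; _++_; [_]; length)
  open import Data.List.Properties using (length-++)
  open import Data.Product using (Σ; proj₁; proj₂)
  open import Data.Sum using (inj₁; inj₂)
  open import Function using (_∘_)
  open import Relation.Binary.PropositionalEquality
    using (_≡_; refl; sym; trans; cong; cong₂; subst; module ≡-Reasoning)
  open BinomialConvolution
  open PolyBernoulliIntegral
  open ExponentialSeries
  open ≡-Reasoning

  -- The sign factor of oneMinusExpNeg and the helpers nth and sumBelow of divExpMinusOne are
  -- private to the definitions. They are recovered by unification, after `with` has abstracted
  -- the non-injective expressions around them into variables.
  signs : Σ (ℕ → ℚ) (λ w → ∀ n → oneMinusExpNeg (suc n) ≡ w n * invFact (suc n))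
  proj₁ signs = _
  proj₂ signs n with _*_
  ... | _ = refl

  nthOf : Σ (List ℚ → ℕ → ℚ) (λ nth → ∀ L n → divExpMinusOne L n ≡ nth (divFirst L (suc n)) n)
  proj₁ nthOf = _
  proj₂ nthOf L n with divFirst L (suc n)
  ... | _ = refl

  nth : List ℚ → ℕ → ℚ
  nth = proj₁ nthOf

  sumBelowOf : Σ (ℕ → (ℕ → ℚ) → ℚ) (λ sumBelow → ∀ L n →
    divFirst L (suc n) ≡
    divFirst L n ++ [ L (suc n) - sumBelow n (λ i → nth (divFirst L n) i * invFact (suc n ∸ i)) ])
  proj₁ sumBelowOf = _
  proj₂ sumBelowOf L n with divFirst L n | L (suc n)
  ... | xs | _ with (λ i → nth xs i * invFact (suc n ∸ i))
  ... | _ = refl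

  sumBelow : ℕ → (ℕ → ℚ) → ℚ
  sumBelow = proj₁ sumBelowOf

  signs≡ι-alt : ∀ n → proj₁ signs n ≡ ι (alt n)
  signs≡ι-alt zero    = refl
  signs≡ι-alt (suc n) = trans (cong (- 1ℚ *_) (signs≡ι-alt n)) (sym (ι-* (ℤ.- 1ℤ) (alt n)))

  oneMinusExpNeg≡egf : ∀ n → oneMinusExpNeg n ≡ egf X n
  oneMinusExpNeg≡egf zero    = refl
  oneMinusExpNeg≡egf (suc n) = trans (proj₂ signs n) (cong (_* invFact (suc n)) (signs≡ι-alt n))

  pow≡egf : ∀ m n → pow oneMinusExpNeg m n ≡ egf (X^ m) n
  pow≡egf zero    zero    = refl
  pow≡egf zero    (suc n) = sym (*-zeroˡ (invFact (suc n)))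
  pow≡egf (suc m) n       = trans (mul-cong oneMinusExpNeg≡egf (pow≡egf m) n) (mul-egf X (X^ m) n)

  partialComp≡egf : ∀ K N n → sumTo N (λ m → LiNeg K m * pow oneMinusExpNeg m n) ≡ egf (Li K N) n
  partialComp≡egf K zero    n = trans (*-zeroˡ (pow oneMinusExpNeg 0 n)) (sym (*-zeroˡ (invFact n)))
  partialComp≡egf K (suc N) n = begin
    sumTo N (λ m → LiNeg K m * pow oneMinusExpNeg m n) + ι c * pow oneMinusExpNeg (suc N) n
      ≡⟨ cong₂ _+_ (partialComp≡egf K N n) (cong (ι c *_) (pow≡egf (suc N) n)) ⟩
    egf (Li K N) n + ι c * egf (X^ suc N) n
      ≡⟨ cong (_+_ (egf (Li K N) n)) (egf-∙ c (X^ suc N) n) ⟨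
    egf (Li K N) n + egf (c ∙ X^ suc N) n
      ≡⟨ egf-⊕ (Li K N) (c ∙ X^ suc N) n ⟨
    egf (Li K (suc N)) n ∎
    where
    c = + (suc N ℕ.^ K)

  comp≡mul : ∀ K n → comp (LiNeg K) oneMinusExpNeg n ≡ mul (egf (polyC K)) (egf expm1) n
  comp≡mul K n = begin
    comp (LiNeg K) oneMinusExpNeg n    ≡⟨ partialComp≡egf K n n ⟩
    egf (Li K n) n                     ≡⟨ cong (λ z → ι z * invFact n) (Li≡expm1⋆polyC K n n ℕ.≤-refl) ⟩
    egf (expm1 ⋆ polyC K) n            ≡⟨ cong (λ z → ι z * invFact n) (⋆-comm expm1 (polyC K) n) ⟩
    egf (polyC K ⋆ expm1) n            ≡⟨ mul-egf (polyC K) expm1 n ⟨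
    mul (egf (polyC K)) (egf expm1) n  ∎

  prefix : (ℕ → ℚ) → ℕ → List ℚ
  prefix h zero    = []
  prefix h (suc n) = prefix h n ++ [ h n ]

  length-prefix : ∀ h n → length (prefix h n) ≡ n
  length-prefix h zero    = refl
  length-prefix h (suc n) = begin
    length (prefix h n ++ [ h n ])  ≡⟨ length-++ (prefix h n) ⟩
    length (prefix h n) ℕ.+ 1       ≡⟨ ℕ.+-comm (length (prefix h n)) 1 ⟩
    suc (length (prefix h n))       ≡⟨ cong suc (length-prefix h n) ⟩
    suc n                           ∎

  nth-++-< : ∀ xs v i → i < length xs → nth (xs ++ [ v ]) i ≡ nth xs i
  nth-++-< (x ∷ xs) v zero    _         = refl
  nth-++-< (x ∷ xs) v (suc i) (s≤s i<n) = nth-++-< xs v i i<n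

  nth-++-length : ∀ xs v → nth (xs ++ [ v ]) (length xs) ≡ v
  nth-++-length []       v = refl
  nth-++-length (x ∷ xs) v = nth-++-length xs v

  nth-prefix : ∀ h n i → i < n → nth (prefix h n) i ≡ h i
  nth-prefix h (suc n) i i<1+n with ℕ.m≤n⇒m<n∨m≡n (ℕ.≤-pred i<1+n)
  ... | inj₁ i<n  =
    trans (nth-++-< (prefix h n) (h n) i (subst (i <_) (sym (length-prefix h n)) i<n)) (nth-prefix h n i i<n)
  ... | inj₂ refl =
    trans (cong (nth (prefix h i ++ [ h i ])) (sym (length-prefix h i))) (nth-++-length (prefix h i) (h i))

  sumBelow-cong : ∀ n {f g} → (∀ i → i < n → f i ≡ g i) → sumBelow n f ≡ sumBelow n g
  sumBelow-cong zero    f≡g = refl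
  sumBelow-cong (suc n) f≡g =
    cong₂ _+_ (sumBelow-cong n (λ i i<n → f≡g i (ℕ.m<n⇒m<1+n i<n))) (f≡g n ℕ.≤-refl)

  sumTo≡sumBelow : ∀ n f → sumTo n f ≡ sumBelow (suc n) f
  sumTo≡sumBelow zero    f = sym (+-identityˡ (f 0))
  sumTo≡sumBelow (suc n) f = cong (_+ f (suc n)) (sumTo≡sumBelow n f)

  mul-egf-expm1 : ∀ h n →
                  mul h (egf expm1) (suc n) ≡ sumBelow n (λ i → h i * invFact (suc n ∸ i)) + h n
  mul-egf-expm1 h n = begin
    sumTo n G + h (suc n) * egf expm1 (n ∸ n)  ≡⟨ cong₂ _+_ (sumTo≡sumBelow n G) top-vanishes ⟩
    sumBelow n G + G n + 0ℚ                    ≡⟨ +-identityʳ (sumBelow n G + G n) ⟩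
    sumBelow n G + G n                         ≡⟨ cong₂ _+_ (sumBelow-cong n lower-terms) last-term ⟩
    sumBelow n (λ i → h i * invFact (suc n ∸ i)) + h n ∎
    where
    G : ℕ → ℚ
    G i = h i * egf expm1 (suc n ∸ i)
    top-vanishes : h (suc n) * egf expm1 (n ∸ n) ≡ 0ℚ
    top-vanishes rewrite ℕ.n∸n≡0 n = *-zeroʳ (h (suc n))
    lower-terms : ∀ i → i < n → G i ≡ h i * invFact (suc n ∸ i)
    lower-terms i i<n rewrite ℕ.+-∸-assoc 1 (ℕ.<⇒≤ i<n) =
      cong (h i *_) (*-identityˡ (invFact (suc (n ∸ i))))
    last-term : G n ≡ h n
    last-term rewrite ℕ.m+n∸n≡m 1 n = *-identityʳ (h n)

  divExpMinusOne-unique : ∀ L h → (∀ n → L (suc n) ≡ mul h (egf expm1) (suc n)) →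
                          ∀ n → divExpMinusOne L n ≡ h n
  divExpMinusOne-unique L h L≡h*expm1 n = begin
    divExpMinusOne L n          ≡⟨ proj₂ nthOf L n ⟩
    nth (divFirst L (suc n)) n  ≡⟨ cong (λ xs → nth xs n) (divFirst≡prefix (suc n)) ⟩
    nth (prefix h (suc n)) n    ≡⟨ nth-prefix h (suc n) n ℕ.≤-refl ⟩
    h n                         ∎
    where
    recurrence : ∀ n → L (suc n) - sumBelow n (λ i → h i * invFact (suc n ∸ i)) ≡ h n
    recurrence n = trans (cong (_- S) (trans (L≡h*expm1 n) (mul-egf-expm1 h n))) (xyx⁻¹≈y S (h n))
      where S = sumBelow n (λ i → h i * invFact (suc n ∸ i))
    divFirst≡prefix : ∀ n → divFirst L n ≡ prefix h n
    divFirst≡prefix zero    = refl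
    divFirst≡prefix (suc n) = begin
      divFirst L (suc n)
        ≡⟨ proj₂ sumBelowOf L n ⟩
      divFirst L n ++ [ L (suc n) - sumBelow n (λ i → nth (divFirst L n) i * invFact (suc n ∸ i)) ]
        ≡⟨ cong₂ (λ xs s → xs ++ [ L (suc n) - s ]) (divFirst≡prefix n)
                 (sumBelow-cong n (λ i i<n → cong (_* invFact (suc n ∸ i))
                   (trans (cong (λ xs → nth xs i) (divFirst≡prefix n)) (nth-prefix h n i i<n)))) ⟩
      prefix h n ++ [ L (suc n) - sumBelow n (λ i → h i * invFact (suc n ∸ i)) ]
        ≡⟨ cong (λ x → prefix h n ++ [ x ]) (recurrence n) ⟩
      prefix h (suc n) ∎

  polyBernoulliCNeg≡polyC : ∀ K n → polyBernoulliCNeg K n ≡ ι (polyC K n)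
  polyBernoulliCNeg≡polyC K n = begin
    ι (+ (n !)) * divExpMinusOne (comp (LiNeg K) oneMinusExpNeg) n
      ≡⟨ cong (ι (+ (n !)) *_) (divExpMinusOne-unique _ (egf (polyC K)) (comp≡mul K ∘ suc) n) ⟩
    ι (+ (n !)) * (ι (polyC K n) * invFact n)
      ≡⟨ x∙yz≈y∙xz (ι (+ (n !))) (ι (polyC K n)) (invFact n) ⟩
    ι (polyC K n) * (ι (+ (n !)) * invFact n)
      ≡⟨ cong (ι (polyC K n) *_) (ι-n!*invFact n) ⟩
    ι (polyC K n) * 1ℚ
      ≡⟨ *-identityʳ (ι (polyC K n)) ⟩
    ι (polyC K n) ∎

open import Defs
open import Data.Nat using (ℕ; suc; _∸_)
open import Data.Nat.Primality using (Prime)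
open import Data.Integer using (ℤ; +_; _-_)
open import Data.Integer.Divisibility using (_∣_)
open import Data.Integer.Divisibility.Signed using (∣⇒∣ᵤ)
open import Data.Rational using (_/_)
open import Data.Product using (∃-syntax; _×_; _,_)
open import Relation.Binary.PropositionalEquality using (_≡_; _≢_)
open PolyBernoulliIntegral using (polyC; polyC-congruence)
open PolyBernoulliRational using (polyBernoulliCNeg≡polyC)

-- The argument does not use p ≢ 2: the congruence holds for p = 2 as well.
theorem3p3 : ∀ (p : ℕ) → Prime p → p ≢ 2 → ∀ (k : ℕ) →
    ∃[ c ] (polyBernoulliCNeg (suc k) (p ∸ 1) ≡ c / 1 × (+ p) ∣ (c - + 1))
theorem3p3 p p-prime _ k =
  polyC (suc k) (p ∸ 1) , polyBernoulliCNeg≡polyC (suc k) (p ∸ 1) , ∣⇒∣ᵤ (polyC-congruence p-prime k)
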